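{- Let $(X, T)$ be a topological dynamical $\mathbb{Q}$-system, let $P(x) \in \mathbb{Q}[x]$, let $x_0 \in X$, and let $U, V \subseteq X$ be open sets. If there exist $(x_1,x_2) \in U \times V$ such that $(x_0,x_1,x_2)$ is an Erdős–Furstenberg–Sárközy $P$-progression, then there exists a sequence $(b_n)_{n \in \mathbb{N}}$ of distinct rationals such that \[ \{b_i : i \in \mathbb{N}\} \subseteq \{q \in \mathbb{Q} : T^q x_0 \in U\}, \qquad \{P(b_i) + b_j : i < j\} \subseteq \{q \in \mathbb{Q} : T^q x_0 \in V\}. \]
   Context: A topological dynamical $\mathbb{Q}$-system is a pair $(X,T)$ with $X$ a compact metric space and $T$ an action of $(\mathbb{Q},+)$ on $X$ by homeomorphisms $T^q$. A triple $(x_0,x_1,x_2) \in X^3$ is an Erdős–Furstenberg–Sárközy $P$-progression if there is a sequence $(s_n)_{n\in\mathbb{N}}$ of distinct rationals with $\lim_{n\to\infty} (T^{s_n}x_0, T^{P(s_n)}x_1) = (x_1,x_2)$. -}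

module Defs where

open import Data.Nat using (ℕ; _≤_; _<_)
open import Data.Rational using (ℚ; 0ℚ; _+_; _*_)
open import Data.List using (List; []; _∷_)
open import Data.List.Relation.Unary.Any using (Any)
open import Data.Product using (Σ; ∃; ∃-syntax; Σ-syntax; _×_; _,_)
open import Data.Unit using (⊤)
open import Data.Empty using (⊥)
open import Relation.Binary.PropositionalEquality using (_≡_)
open import Relation.Nullary using (¬_)

Subset : Set → Set₁
Subset X = X → Set

-- A topological space: a carrier together with a predicate "is open" on
-- subsets, satisfying the usual axioms (and invariance under equality of
-- subsets, since subsets are represented intensionally as predicates).
record TopSpace : Set₁ where
  field
    Carrier      : Set
    IsOpen       : Subset Carrier → Set
    open-ext     : (U V : Subset Carrier) → (∀ x → U x → V x) → (∀ x → V x → U x) →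
                   IsOpen U → IsOpen V
    open-empty   : IsOpen (λ _ → ⊥)
    open-whole   : IsOpen (λ _ → ⊤)
    open-inter   : (U V : Subset Carrier) → IsOpen U → IsOpen V → IsOpen (λ x → U x × V x)
    open-union   : (I : Set) (U : I → Subset Carrier) → (∀ i → IsOpen (U i)) →
                   IsOpen (λ x → ∃[ i ] U i x)

module _ (X : TopSpace) where
  open TopSpace X

  IsCompact : Set₁
  IsCompact = (I : Set) (U : I → Subset Carrier) → (∀ i → IsOpen (U i)) →
              (∀ x → ∃[ i ] U i x) →
              Σ[ is ∈ List I ] (∀ x → Any (λ i → U i x) is)

  IsHausdorff : Set₁
  IsHausdorff = (x y : Carrier) → ¬ (x ≡ y) →
                Σ[ U ∈ Subset Carrier ] Σ[ V ∈ Subset Carrier ] (IsOpen U × IsOpen V × U x × V y ×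
                               (∀ z → U z → V z → ⊥))

  IsSecondCountable : Set₁
  IsSecondCountable = Σ[ B ∈ (ℕ → Subset Carrier) ] ((∀ (n : ℕ) → IsOpen (B n)) ×
                       (∀ (U : Subset Carrier) → IsOpen U → ∀ x → U x →
                          ∃[ n ] (B n x × (∀ y → B n y → U y))))

  -- Compact metrizable = compact Hausdorff second countable (Urysohn).
  IsCompactMetrizable : Set₁
  IsCompactMetrizable = IsCompact × IsHausdorff × IsSecondCountable

  ConvergesTo : (ℕ → Carrier) → Carrier → Set₁
  ConvergesTo s x = (U : Subset Carrier) → IsOpen U → U x →
                    ∃[ N ] (∀ n → N ≤ n → U (s n))

  -- An action of (ℚ,+) on X by homeomorphisms: T⁰ = id, T^{p+q} = T^p ∘ T^q,
  -- each T^q continuous (its inverse T^{-q} then is continuous too).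
  record IsQAction (T : ℚ → Carrier → Carrier) : Set₁ where
    field
      act-zero : ∀ x → T 0ℚ x ≡ x
      act-add  : ∀ p q x → T (p + q) x ≡ T p (T q x)
      act-cont : ∀ q (U : Subset Carrier) → IsOpen U → IsOpen (λ x → U (T q x))

-- Polynomials in ℚ[x] as coefficient lists [a₀, a₁, …] (constant term first).
Poly : Set
Poly = List ℚ

eval : Poly → ℚ → ℚ
eval []       x = 0ℚ
eval (a ∷ as) x = a + x * eval as x

Distinct : (ℕ → ℚ) → Set
Distinct s = ∀ i j → s i ≡ s j → i ≡ j

-- (x₀,x₁,x₂) is an Erdős–Furstenberg–Sárközy P-progression
-- (convergence in X × X is written componentwise).
IsEFSProgression : (X : TopSpace) (T : ℚ → TopSpace.Carrier X → TopSpace.Carrier X) →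
                   Poly → (x₀ x₁ x₂ : TopSpace.Carrier X) → Set₁
IsEFSProgression X T P x₀ x₁ x₂ =
  ∃[ s ] (Distinct s ×
          ConvergesTo X (λ n → T (s n) x₀) x₁ ×
          ConvergesTo X (λ n → T (eval P (s n)) x₁) x₂)

{-# OPTIONS --safe #-}
module Submission where

-- Pass to a tail of s on which T^{s n} x₀ ∈ U and T^{P(s n)} x₁ ∈ V. For each n, continuity
-- of T^{P(s n)} at x₁ and T^{s k} x₀ → x₁ give a threshold h n with T^{P(s n) + s k} x₀ ∈ V
-- for all k ≥ h n. Indices n₀ < n₁ < … with n_{i+1} > h(n_i) then yield b_i = s_{n_i}.

open import Defs
open import Data.Nat as ℕ using (ℕ; zero; suc; _⊔_; _≤_; _<_; s≤s)
open import Data.Nat.Properties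
  using (≤-refl; ≤-trans; <-trans; <-≤-trans; <⇒≤; <-cmp; <-irrefl; m≤m+n; m≤n+m;
         m⊔n≤o⇒m≤o; m⊔n≤o⇒n≤o; m<1+n⇒m<n∨m≡n; m≤n⇒m<n∨m≡n; +-cancelˡ-≡)
open import Data.Rational using (ℚ; _+_)
open import Data.Product using (∃-syntax; _×_; _,_; proj₁; proj₂)
open import Data.Sum using (inj₁; inj₂)
open import Data.Empty using (⊥-elim)
open import Function using (_∘_)
open import Function.Definitions using (Injective)
open import Relation.Binary.Definitions using (tri<; tri≈; tri>)
open import Relation.Binary.PropositionalEquality using (_≡_; refl; sym; subst)

private
  variable
    i j : ℕ

Eventually : (ℕ → Set) → Set
Eventually P = ∃[ N ] (∀ n → N ≤ n → P n)

eventually-× : ∀ {P Q : ℕ → Set} → Eventually P → Eventually Q →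
               Eventually (λ n → P n × Q n)
eventually-× (M , p) (N , q) =
  M ⊔ N , λ n M⊔N≤n → p n (m⊔n≤o⇒m≤o M N M⊔N≤n) , q n (m⊔n≤o⇒n≤o M N M⊔N≤n)

module _ {f : ℕ → ℕ} (f-step : ∀ k → f k < f (suc k)) where

  step-mono-< : i < j → f i < f j
  step-mono-< {i} {suc j} i<1+j with m<1+n⇒m<n∨m≡n i<1+j
  ... | inj₁ i<j  = <-trans (step-mono-< i<j) (f-step j)
  ... | inj₂ refl = f-step i

  step-mono-≤ : i ≤ j → f i ≤ f j
  step-mono-≤ i≤j with m≤n⇒m<n∨m≡n i≤j
  ... | inj₁ i<j  = <⇒≤ (step-mono-< i<j)
  ... | inj₂ refl = ≤-refl

  step-injective : Injective _≡_ _≡_ f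
  step-injective {i} {j} fi≡fj with <-cmp i j
  ... | tri< i<j _ _ = ⊥-elim (<-irrefl fi≡fj (step-mono-< i<j))
  ... | tri≈ _ i≡j _ = i≡j
  ... | tri> _ _ j<i = ⊥-elim (<-irrefl (sym fi≡fj) (step-mono-< j<i))

module _ (h : ℕ → ℕ) where

  leapfrog : ℕ → ℕ
  leapfrog zero    = zero
  leapfrog (suc i) = suc (leapfrog i ℕ.+ h (leapfrog i))

  leapfrog-step : ∀ k → leapfrog k < leapfrog (suc k)
  leapfrog-step k = s≤s (m≤m+n (leapfrog k) _)

  leapfrog-injective : Injective _≡_ _≡_ leapfrog
  leapfrog-injective = step-injective leapfrog-step

  h-leapfrog-< : i < j → h (leapfrog i) < leapfrog j
  h-leapfrog-< {i} i<j =
    <-≤-trans (s≤s (m≤n+m (h (leapfrog i)) (leapfrog i))) (step-mono-≤ leapfrog-step i<j)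

distinct-∘ : ∀ {s : ℕ → ℚ} {f : ℕ → ℕ} → Distinct s → Injective _≡_ _≡_ f → Distinct (s ∘ f)
distinct-∘ s-distinct f-injective i j sfi≡sfj = f-injective (s-distinct _ _ sfi≡sfj)

module _ (X : TopSpace) {T : ℚ → TopSpace.Carrier X → TopSpace.Carrier X}
         (act : IsQAction X T) where
  open TopSpace X
  open IsQAction act

  eventually-translate : ∀ {t : ℕ → ℚ} {x₀ x₁ q} {V : Subset Carrier} → IsOpen V →
                         ConvergesTo X (λ k → T (t k) x₀) x₁ → V (T q x₁) →
                         Eventually (λ k → V (T (q + t k) x₀))
  eventually-translate {t} {x₀} {q = q} {V} V-open t→x₁ Tqx₁∈V
    with N , Tqtx₀∈V ← t→x₁ (λ x → V (T q x)) (act-cont q V V-open) Tqx₁∈V =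
    N , λ k N≤k → subst V (sym (act-add q (t k) x₀)) (Tqtx₀∈V k N≤k)

proposition2p4 : (X : TopSpace) → IsCompactMetrizable X →
    (T : ℚ → TopSpace.Carrier X → TopSpace.Carrier X) → IsQAction X T →
    (P : Poly) (x₀ : TopSpace.Carrier X)
    (U V : Subset (TopSpace.Carrier X)) → TopSpace.IsOpen X U → TopSpace.IsOpen X V →
    (∃[ x₁ ] ∃[ x₂ ] (U x₁ × V x₂ × IsEFSProgression X T P x₀ x₁ x₂)) →
    ∃[ b ] (Distinct b ×
            (∀ i → U (T (b i) x₀)) ×
            (∀ i j → i < j → V (T (eval P (b i) + b j) x₀)))
proposition2p4 X _ T act P x₀ U V U-open V-open
  (x₁ , x₂ , x₁∈U , x₂∈V , s , s-distinct , s→x₁ , Ps→x₂) =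
  b , distinct-∘ s-distinct (leapfrog-injective h ∘ +-cancelˡ-≡ N _ _) , b∈U , Pb+b∈V
  where
  good : Eventually (λ n → U (T (s n) x₀) × V (T (eval P (s n)) x₁))
  good = eventually-× (s→x₁ U U-open x₁∈U) (Ps→x₂ V V-open x₂∈V)

  N : ℕ
  N = proj₁ good

  good-tail : ∀ n → U (T (s (N ℕ.+ n)) x₀) × V (T (eval P (s (N ℕ.+ n))) x₁)
  good-tail n = proj₂ good (N ℕ.+ n) (m≤m+n N n)

  returns : ∀ n → Eventually (λ k → V (T (eval P (s (N ℕ.+ n)) + s k) x₀))
  returns n = eventually-translate X act V-open s→x₁ (proj₂ (good-tail n))

  h : ℕ → ℕ
  h n = proj₁ (returns n)

  b : ℕ → ℚ
  b i = s (N ℕ.+ leapfrog h i)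

  b∈U : ∀ i → U (T (b i) x₀)
  b∈U i = proj₁ (good-tail (leapfrog h i))

  Pb+b∈V : ∀ i j → i < j → V (T (eval P (b i) + b j) x₀)
  Pb+b∈V i j i<j = proj₂ (returns (leapfrog h i)) (N ℕ.+ leapfrog h j)
    (≤-trans (<⇒≤ (h-leapfrog-< h i<j)) (m≤n+m (leapfrog h j) N))
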